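{- Let $G$ be a connected graph and $H$ any graph. Then $\gamma(G\diamond H)=\beta(G)$.
   Context: For a simple graph $G$ with edges $e_1,\dots,e_m$ and a graph $H$, the edge corona product $G\diamond H$ is the graph obtained by taking one copy of $G$ and $m$ vertex-disjoint copies $H_1,\dots,H_m$ of $H$ and joining both end vertices of $e_i$ to every vertex of $H_i$, $1\le i\le m$. $\gamma$ denotes the domination number and $\beta(G)$ the vertex covering number (minimum size of a set of vertices meeting every edge) of $G$. -}

module Defs where

open import Data.Nat using (ℕ; _+_; _*_; _≤_)
open import Data.Bool using (Bool; true; false; _∧_; _∨_)
open import Data.Fin using (Fin; splitAt; remQuot; _<?_; _≟_)
open import Data.Fin.Subset using (Subset; _∈_; ∣_∣)
open import Data.List using (List; []; _∷_; length; lookup; filterᵇ; concatMap; map; allFin)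
open import Data.Product using (Σ; ∃; _×_; _,_; proj₁; proj₂)
open import Data.Sum using (_⊎_; inj₁; inj₂)
open import Relation.Binary.PropositionalEquality using (_≡_)
open import Relation.Nullary.Decidable using (does)

record Graph : Set where
  field
    order : ℕ
    adj   : Fin order → Fin order → Bool
open Graph public

record IsSimple (G : Graph) : Set where
  field
    symm    : ∀ u v → adj G u v ≡ true → adj G v u ≡ true
    irrefl  : ∀ v → adj G v v ≡ false

data Walk (G : Graph) : Fin (order G) → Fin (order G) → Set where
  here : ∀ {v} → Walk G v v
  step : ∀ {u w v} → adj G u w ≡ true → Walk G w v → Walk G u v

Connected : Graph → Set
Connected G = ∀ u v → Walk G u v

edges : (G : Graph) → List (Fin (order G) × Fin (order G))
edges G = filterᵇ (λ p → does (proj₁ p <? proj₂ p) ∧ adj G (proj₁ p) (proj₂ p))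
                  (concatMap (λ i → map (λ j → (i , j)) (allFin (order G))) (allFin (order G)))

size : Graph → ℕ
size G = length (edges G)

-- Edge corona G ◇ H.  Vertex set Fin (n + m * k):
--   inj₁ v          : vertex v of G,
--   inj₂ r, remQuot r = (e , h) : vertex h of the copy H_e attached to edge e.
private
  isEnd : ∀ {n} → Fin n → Fin n × Fin n → Bool
  isEnd v (a , b) = does (v ≟ a) ∨ does (v ≟ b)

_◇_ : Graph → Graph → Graph
G ◇ H = record { order = order G + size G * order H ; adj = A }
  where
  A : Fin (order G + size G * order H) → Fin (order G + size G * order H) → Bool
  A x y with splitAt (order G) x | splitAt (order G) y
  ... | inj₁ u | inj₁ v = adj G u v
  ... | inj₁ u | inj₂ r = isEnd u (lookup (edges G) (proj₁ (remQuot (order H) r)))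
  ... | inj₂ r | inj₁ v = isEnd v (lookup (edges G) (proj₁ (remQuot (order H) r)))
  ... | inj₂ r | inj₂ s with remQuot {size G} (order H) r | remQuot {size G} (order H) s
  ...   | (e , h) | (e' , h') = does (e ≟ e') ∧ adj H h h'

Dominating : (G : Graph) → Subset (order G) → Set
Dominating G S = ∀ v → v ∈ S ⊎ ∃ λ u → u ∈ S × adj G u v ≡ true

VertexCover : (G : Graph) → Subset (order G) → Set
VertexCover G S = ∀ u v → adj G u v ≡ true → u ∈ S ⊎ v ∈ S

IsMinCard : ∀ {n} → (Subset n → Set) → ℕ → Set
IsMinCard P k = (∃ λ S → P S × ∣ S ∣ ≡ k) × (∀ S → P S → k ≤ ∣ S ∣)

IsDominationNumber : Graph → ℕ → Set
IsDominationNumber G = IsMinCard (Dominating G)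

IsVertexCoveringNumber : Graph → ℕ → Set
IsVertexCoveringNumber G = IsMinCard (VertexCover G)

module Submission where

-- A vertex cover C of G, viewed inside G ◇ H, dominates:
-- every vertex of a copy H_e is adjacent to both endpoints of e, one of
-- which lies in C, and every vertex u ∉ C of G has a neighbour (G has no
-- isolated vertex), which must lie in C.  So γ(G ◇ H) ≤ |C| = β(G).
--
-- Project G ◇ H onto G by sending a vertex of G to itself
-- and a vertex of H_e to the first endpoint of e.  Every dominator of a
-- vertex of H_e projects to an endpoint of e, so the projection of a
-- dominating set D is a vertex cover of G of size at most |D|.

open import Defs
open import Data.Nat using (ℕ; zero; suc; _+_; _*_; _≤_; z≤n; s≤s)
open import Data.Nat.Properties using (≤-refl; ≤-reflexive; ≤-trans; +-mono-≤; +-suc; module ≤-Reasoning)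
open import Data.Bool using (Bool; true; false; _∧_; _∨_; T)
open import Data.Bool.Properties using (T-∧; T-≡)
open import Data.Fin using (Fin; splitAt; remQuot; combine; _↑ˡ_; _↑ʳ_; _≟_; _<_; _<?_)
open import Data.Fin.Properties using (splitAt-↑ˡ; splitAt-↑ʳ; join-splitAt; remQuot-combine; combine-remQuot; <-cmp)
open import Data.Fin.Subset using (Subset; _∈_; ∣_∣; inside; outside; ⁅_⁆; _∪_; ⊥)
open import Data.Fin.Subset.Properties using (_∈?_; x∈p∪q⁺; x∈⁅x⁆; ∣⁅x⁆∣≡1; ∣⊥∣≡0; ∣p∣≤∣x∷p∣)
open import Data.Vec using ([]; _∷_; _++_; here; there)
open import Data.List using (List; lookup; allFin; concatMap; map)
open import Data.List.Membership.Propositional using () renaming (_∈_ to _∈ₗ_)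
open import Data.List.Membership.Propositional.Properties using (∈-lookup; ∈-filter⁻; ∈-filter⁺; ∈-concatMap⁺; ∈-map⁺; ∈-allFin)
open import Data.List.Relation.Unary.Any as Any using ()
open import Data.List.Relation.Unary.Any.Properties using (lookup-index)
open import Data.Product using (∃; _×_; _,_; proj₁; proj₂)
open import Data.Sum using (_⊎_; inj₁; inj₂; [_,_]′; swap) renaming (map to map-⊎)
open import Data.Empty using (⊥-elim)
open import Function using (_∘_; id; Equivalence)
open import Relation.Binary using (tri<; tri≈; tri>)
open import Relation.Binary.PropositionalEquality using (_≡_; _≢_; refl; sym; trans; cong; cong₂; subst)
open import Relation.Nullary using (yes; no; does)
open import Relation.Nullary.Decidable using (T?; dec-true)

-- Endpoint test: v is an endpoint of the pair e.  This is exactly the test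
-- used by the definition of G ◇ H for adjacency between G and a copy of H.
incident : ∀ {N} → Fin N → Fin N × Fin N → Bool
incident v e = does (v ≟ proj₁ e) ∨ does (v ≟ proj₂ e)

incident-proj₁ : ∀ {N} (e : Fin N × Fin N) → incident (proj₁ e) e ≡ true
incident-proj₁ (a , b) rewrite dec-true (a ≟ a) refl = refl

incident-proj₂ : ∀ {N} (e : Fin N × Fin N) → incident (proj₂ e) e ≡ true
incident-proj₂ (a , b) with b ≟ a
... | yes _ = refl
... | no _ rewrite dec-true (b ≟ b) refl = refl

incident⇒endpoint : ∀ {N} {v a b : Fin N} → incident v (a , b) ≡ true → v ≡ a ⊎ v ≡ b
incident⇒endpoint {v = v} {a} {b} inc with v ≟ a | v ≟ b
... | yes v≡a | _     = inj₁ v≡a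
... | no _    | yes v≡b = inj₂ v≡b
... | no _    | no _  with inc
...   | ()

incident-unordered : ∀ {N} {w u v : Fin N} (p : Fin N × Fin N) → p ≡ (u , v) ⊎ p ≡ (v , u) →
                     incident w p ≡ true → w ≡ u ⊎ w ≡ v
incident-unordered _ (inj₁ refl) inc = incident⇒endpoint inc
incident-unordered _ (inj₂ refl) inc = swap (incident⇒endpoint inc)

≟-∧-sound : ∀ {N} {e e' : Fin N} (c : Bool) → (does (e ≟ e') ∧ c) ≡ true → e ≡ e'
≟-∧-sound {e = e} {e'} c p with e ≟ e'
... | yes e≡e' = e≡e'
... | no _ with p
...   | ()

∣p∪q∣≤∣p∣+∣q∣ : ∀ {N} (p q : Subset N) → ∣ p ∪ q ∣ ≤ ∣ p ∣ + ∣ q ∣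
∣p∪q∣≤∣p∣+∣q∣ []            []            = z≤n
∣p∪q∣≤∣p∣+∣q∣ (inside ∷ p)  (x ∷ q)       = s≤s (≤-trans (∣p∪q∣≤∣p∣+∣q∣ p q) (+-mono-≤ (≤-refl {∣ p ∣}) (∣p∣≤∣x∷p∣ x q)))
∣p∪q∣≤∣p∣+∣q∣ (outside ∷ p) (inside ∷ q)  = ≤-trans (s≤s (∣p∪q∣≤∣p∣+∣q∣ p q)) (≤-reflexive (sym (+-suc ∣ p ∣ ∣ q ∣)))
∣p∪q∣≤∣p∣+∣q∣ (outside ∷ p) (outside ∷ q) = ∣p∪q∣≤∣p∣+∣q∣ p q

∣p++⊥∣≡∣p∣ : ∀ {N M} (p : Subset N) → ∣ p ++ ⊥ {M} ∣ ≡ ∣ p ∣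
∣p++⊥∣≡∣p∣ {M = M} []    = ∣⊥∣≡0 M
∣p++⊥∣≡∣p∣ (inside ∷ p)  = cong suc (∣p++⊥∣≡∣p∣ p)
∣p++⊥∣≡∣p∣ (outside ∷ p) = ∣p++⊥∣≡∣p∣ p

∈-++⁺ˡ : ∀ {N M} {x : Fin N} {p : Subset N} (q : Subset M) → x ∈ p → (x ↑ˡ M) ∈ (p ++ q)
∈-++⁺ˡ q here        = here
∈-++⁺ˡ q (there x∈p) = there (∈-++⁺ˡ q x∈p)

image : ∀ {N M} → (Fin N → Fin M) → Subset N → Subset M
image f []           = ⊥
image f (outside ∷ p) = image (f ∘ Fin.suc) p
image f (inside ∷ p)  = ⁅ f Fin.zero ⁆ ∪ image (f ∘ Fin.suc) p

∈-image : ∀ {N M} (f : Fin N → Fin M) (p : Subset N) {x : Fin N} → x ∈ p → f x ∈ image f p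
∈-image f (inside ∷ p)  here        = x∈p∪q⁺ (inj₁ (x∈⁅x⁆ _))
∈-image f (inside ∷ p)  (there x∈p) = x∈p∪q⁺ (inj₂ (∈-image (f ∘ Fin.suc) p x∈p))
∈-image f (outside ∷ p) (there x∈p) = ∈-image (f ∘ Fin.suc) p x∈p

∣image∣≤ : ∀ {N M} (f : Fin N → Fin M) (p : Subset N) → ∣ image f p ∣ ≤ ∣ p ∣
∣image∣≤ {M = M} f []   = ≤-reflexive (∣⊥∣≡0 M)
∣image∣≤ f (outside ∷ p) = ∣image∣≤ (f ∘ Fin.suc) p
∣image∣≤ f (inside ∷ p)  = begin
  ∣ ⁅ f Fin.zero ⁆ ∪ image (f ∘ Fin.suc) p ∣     ≤⟨ ∣p∪q∣≤∣p∣+∣q∣ ⁅ f Fin.zero ⁆ _ ⟩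
  ∣ ⁅ f Fin.zero ⁆ ∣ + ∣ image (f ∘ Fin.suc) p ∣ ≡⟨ cong (_+ ∣ image (f ∘ Fin.suc) p ∣) (∣⁅x⁆∣≡1 (f Fin.zero)) ⟩
  suc ∣ image (f ∘ Fin.suc) p ∣                 ≤⟨ s≤s (∣image∣≤ (f ∘ Fin.suc) p) ⟩
  suc ∣ p ∣                                     ∎
  where open ≤-Reasoning

inhabitant : ∀ {N} → 1 ≤ N → Fin N
inhabitant {suc N} _ = Fin.zero

another-vertex : ∀ {N} → 2 ≤ N → (u : Fin N) → ∃ λ w → u ≢ w
another-vertex {suc zero}    (s≤s ()) _
another-vertex {suc (suc N)} _ Fin.zero    = Fin.suc Fin.zero , λ ()
another-vertex {suc (suc N)} _ (Fin.suc u) = Fin.zero , λ ()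

no-isolated-vertex : (G : Graph) → Connected G → 2 ≤ order G → ∀ u → ∃ λ w → adj G u w ≡ true
no-isolated-vertex G conn two u with another-vertex two u
... | w , u≢w = first-step (conn u w) u≢w
  where
  first-step : ∀ {a b} → Walk G a b → a ≢ b → ∃ λ w → adj G a w ≡ true
  first-step here                a≢b = ⊥-elim (a≢b refl)
  first-step (step {w = w} aw _) _   = w , aw

module EdgeList (G : Graph) where

  edge : Fin (size G) → Fin (order G) × Fin (order G)
  edge = lookup (edges G)

  private
    isListed : Fin (order G) × Fin (order G) → Bool
    isListed p = does (proj₁ p <? proj₂ p) ∧ adj G (proj₁ p) (proj₂ p)

    pairs : List (Fin (order G) × Fin (order G))
    pairs = concatMap (λ i → map (λ j → (i , j)) (allFin (order G))) (allFin (order G))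

  edge-adjacent : ∀ e → adj G (proj₁ (edge e)) (proj₂ (edge e)) ≡ true
  edge-adjacent e = Equivalence.to T-≡ (proj₂ (Equivalence.to T-∧ listed))
    where
    listed : T (isListed (edge e))
    listed = proj₂ (∈-filter⁻ (T? ∘ isListed) {xs = pairs} (∈-lookup e))

  listed-edge : ∀ a b → adj G a b ≡ true → a < b → ∃ λ e → edge e ≡ (a , b)
  listed-edge a b ab a<b = Any.index listed , sym (lookup-index listed)
    where
    listed : (a , b) ∈ₗ edges G
    listed = ∈-filter⁺ (T? ∘ isListed)
      (∈-concatMap⁺ _ (Any.map (λ { refl → ∈-map⁺ _ (∈-allFin b) }) (∈-allFin a)))
      (Equivalence.from T-∧ (Equivalence.from T-≡ (dec-true (a <? b) a<b) , Equivalence.from T-≡ ab))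

  edge-index : IsSimple G → ∀ {u v} → adj G u v ≡ true → ∃ λ e → edge e ≡ (u , v) ⊎ edge e ≡ (v , u)
  edge-index sG {u} {v} uv with <-cmp u v
  ... | tri< u<v _ _ = let e , eq = listed-edge u v uv u<v in e , inj₁ eq
  ... | tri≈ _ refl _ = ⊥-elim (true≢false (trans (sym uv) (IsSimple.irrefl sG u)))
    where
    true≢false : true ≢ false
    true≢false ()
  ... | tri> _ _ v<u = let e , eq = listed-edge v u (IsSimple.symm sG u v uv) v<u in e , inj₂ eq

module Corona (G H : Graph) where
  open EdgeList G

  n m k : ℕ
  n = order G
  m = size G
  k = order H

  base : Fin n → Fin (order (G ◇ H))
  base u = u ↑ˡ (m * k)

  copy : Fin m → Fin k → Fin (order (G ◇ H))
  copy e h = n ↑ʳ combine e h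

  data Vertex : Fin (order (G ◇ H)) → Set where
    base-vertex : ∀ u → Vertex (base u)
    copy-vertex : ∀ e h → Vertex (copy e h)

  vertex : ∀ x → Vertex x
  vertex x with splitAt n x | join-splitAt n (m * k) x
  ... | inj₁ u | refl = base-vertex u
  ... | inj₂ r | refl = subst (λ r → Vertex (n ↑ʳ r)) (combine-remQuot {m} k r) (copy-vertex _ _)

  adj-base-base : ∀ u v → adj (G ◇ H) (base u) (base v) ≡ adj G u v
  adj-base-base u v rewrite splitAt-↑ˡ n u (m * k) | splitAt-↑ˡ n v (m * k) = refl

  adj-base-copy : ∀ u e h → adj (G ◇ H) (base u) (copy e h) ≡ incident u (edge e)
  adj-base-copy u e h
    rewrite splitAt-↑ˡ n u (m * k) | splitAt-↑ʳ n (m * k) (combine e h) =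
      cong (λ q → incident u (edge (proj₁ q))) (remQuot-combine e h)

  adj-copy-copy : ∀ e h e' h' → adj (G ◇ H) (copy e h) (copy e' h') ≡ (does (e ≟ e') ∧ adj H h h')
  adj-copy-copy e h e' h'
    rewrite splitAt-↑ʳ n (m * k) (combine e h) | splitAt-↑ʳ n (m * k) (combine e' h') =
      cong₂ (λ q q' → does (proj₁ q ≟ proj₁ q') ∧ adj H (proj₂ q) (proj₂ q'))
            (remQuot-combine e h) (remQuot-combine e' h')

  project : Fin (order (G ◇ H)) → Fin n
  project x = [ id , proj₁ ∘ edge ∘ proj₁ ∘ remQuot {m} k ]′ (splitAt n x)

  project-base : ∀ u → project (base u) ≡ u
  project-base u rewrite splitAt-↑ˡ n u (m * k) = refl

  project-copy : ∀ e h → project (copy e h) ≡ proj₁ (edge e)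
  project-copy e h rewrite splitAt-↑ʳ n (m * k) (combine e h) =
    cong (proj₁ ∘ edge ∘ proj₁) (remQuot-combine e h)

  lift : Subset n → Subset (order (G ◇ H))
  lift C = C ++ ⊥

  cover-dominates : IsSimple G → Connected G → 2 ≤ n →
                    (C : Subset n) → VertexCover G C → Dominating (G ◇ H) (lift C)
  cover-dominates sG conn two C cover x with vertex x
  ... | base-vertex u with u ∈? C
  ...   | yes u∈C = inj₁ (∈-++⁺ˡ ⊥ u∈C)
  ...   | no u∉C with no-isolated-vertex G conn two u
  ...     | w , uw with cover u w uw
  ...       | inj₁ u∈C = ⊥-elim (u∉C u∈C)
  ...       | inj₂ w∈C = inj₂ (base w , ∈-++⁺ˡ ⊥ w∈C , trans (adj-base-base w u) (IsSimple.symm sG u w uw))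
  cover-dominates sG conn two C cover x | copy-vertex e h with cover _ _ (edge-adjacent e)
  ... | inj₁ a∈C = inj₂ (base _ , ∈-++⁺ˡ ⊥ a∈C , trans (adj-base-copy _ e h) (incident-proj₁ (edge e)))
  ... | inj₂ b∈C = inj₂ (base _ , ∈-++⁺ˡ ⊥ b∈C , trans (adj-base-copy _ e h) (incident-proj₂ (edge e)))

  module _ (D : Subset (order (G ◇ H))) (dom : Dominating (G ◇ H) D) where

    shadow : Subset n
    shadow = image project D

    ∈-shadow : ∀ {x w} → x ∈ D → project x ≡ w → w ∈ shadow
    ∈-shadow x∈D refl = ∈-image project D x∈D

    -- The vertex copy e h is dominated from a vertex whose projection is an
    -- endpoint of e: G-neighbours of copy e h are endpoints of e, and
    -- H-neighbours lie in the same copy H_e.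
    endpoint-in-shadow : ∀ e h → ∃ λ w → w ∈ shadow × incident w (edge e) ≡ true
    endpoint-in-shadow e h with dom (copy e h)
    ... | inj₁ x∈D = proj₁ (edge e) , ∈-shadow x∈D (project-copy e h) , incident-proj₁ (edge e)
    ... | inj₂ (z , z∈D , zx) with vertex z
    ...   | base-vertex w = w , ∈-shadow z∈D (project-base w) , trans (sym (adj-base-copy w e h)) zx
    ...   | copy-vertex e' h' =
      proj₁ (edge e) , ∈-shadow z∈D (trans (project-copy e' h') (cong (proj₁ ∘ edge) e'≡e)) , incident-proj₁ (edge e)
      where
      e'≡e : e' ≡ e
      e'≡e = ≟-∧-sound (adj H h' h) (trans (sym (adj-copy-copy e' h' e h)) zx)

    shadow-covers : IsSimple G → 1 ≤ k → VertexCover G shadow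
    shadow-covers sG one u v uv with edge-index sG uv
    ... | e , orientation with endpoint-in-shadow e (inhabitant one)
    ...   | w , w∈shadow , inc =
      map-⊎ (λ w≡u → subst (_∈ shadow) w≡u w∈shadow) (λ w≡v → subst (_∈ shadow) w≡v w∈shadow)
            (incident-unordered (edge e) orientation inc)

    ∣shadow∣≤∣D∣ : ∣ shadow ∣ ≤ ∣ D ∣
    ∣shadow∣≤∣D∣ = ∣image∣≤ project D

mainTheorem13 : (G H : Graph) → IsSimple G → IsSimple H → Connected G → 2 ≤ order G → 1 ≤ order H → (k : ℕ) → IsVertexCoveringNumber G k → IsDominationNumber (G ◇ H) k
mainTheorem13 G H sG _ conn two one β ((C , cover , ∣C∣≡β) , β-minimal) =
  (lift C , cover-dominates sG conn two C cover , trans (∣p++⊥∣≡∣p∣ C) ∣C∣≡β) ,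
  λ D dom → ≤-trans (β-minimal (shadow D dom) (shadow-covers D dom sG one)) (∣shadow∣≤∣D∣ D dom)
  where open Corona G H
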